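{- Let $G$ be a graph with $\delta(G)\geq 1$. Then (i) $\gamma_{\mathrm{SMB}}(G)=2$ if and only if $G$ has at least two strong support vertices; and (ii) $\gamma_{\mathrm{SMB}}'(G)=2$ if and only if $G$ has a strong support vertex.
   Context: All graphs are finite and simple; $\delta(G)$ is the minimum degree. A leaf is a vertex of degree $1$; a strong support vertex is a vertex adjacent to at least two leaves. The Maker-Breaker domination game on a graph $G$: Dominator and Staller alternately select a not yet selected vertex of $G$. Dominator wins if his selected vertices contain a dominating set of $G$; Staller wins if she selects at least one vertex from every dominating set of $G$. In the D-game Dominator moves first, in the S-game Staller moves first. $\gamma_{\mathrm{SMB}}(G)$ (resp. $\gamma_{\mathrm{SMB}}'(G)$) is the minimum number of moves Staller needs to win the D-game (resp. S-game) on $G$ when both players play optimally, and is $\infty$ if Staller has no winning strategy. -}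

module Defs where

open import Data.Nat using (ℕ; zero; suc; _≤_; _<_)
open import Data.Fin using (Fin)
open import Data.Fin.Subset using (Subset; _∈_; _∉_; _⊆_; ∣_∣; ⁅_⁆; _∪_; ⊥)
open import Data.Bool using (Bool; true; false)
open import Data.Vec using (tabulate)
open import Data.Product using (Σ; ∃; ∃-syntax; _×_; _,_)
open import Data.Sum using (_⊎_)
import Data.Empty as E
open import Relation.Nullary using (¬_)
open import Relation.Binary.PropositionalEquality using (_≡_; _≢_)

record Graph (n : ℕ) : Set where
  field
    adj   : Fin n → Fin n → Bool
    sym   : ∀ u v → adj u v ≡ adj v u
    irrefl : ∀ v → adj v v ≡ false

module _ {n : ℕ} (G : Graph n) where
  open Graph G

  Adj : Fin n → Fin n → Set
  Adj u v = adj u v ≡ true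

  N : Fin n → Subset n
  N v = tabulate (adj v)

  deg : Fin n → ℕ
  deg v = ∣ N v ∣

  MinDegAtLeast1 : Set
  MinDegAtLeast1 = ∀ v → 1 ≤ deg v

  Leaf : Fin n → Set
  Leaf v = deg v ≡ 1

  StrongSupport : Fin n → Set
  StrongSupport v = ∃[ x ] ∃[ y ] (x ≢ y × Adj v x × Adj v y × Leaf x × Leaf y)

  Dominating : Subset n → Set
  Dominating D = ∀ v → v ∈ D ⊎ (∃[ u ] (u ∈ D × Adj u v))

  -- Game positions: (vertices selected by Dominator, by Staller).
  Free : Subset n → Subset n → Fin n → Set
  Free Dm St v = v ∉ Dm × v ∉ St

  DominatorWon : Subset n → Set
  DominatorWon Dm = ∃[ D ] (Dominating D × D ⊆ Dm)

  StallerWon : Subset n → Set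
  StallerWon St = ∀ D → Dominating D → ∃[ v ] (v ∈ D × v ∈ St)

  -- StallerWinsS k Dm St : Staller to move; she can force a win using at most
  -- k further moves of her own, whatever Dominator does.
  -- StallerWinsD k Dm St : same, Dominator to move.
  -- (Staller's move cannot make Dominator win and vice versa, so only the
  -- mover's win condition is checked after each move.)
  StallerWinsS : ℕ → Subset n → Subset n → Set
  StallerWinsD : ℕ → Subset n → Subset n → Set
  StallerWinsS zero    Dm St = E.⊥
  StallerWinsS (suc k) Dm St =
    ∃[ v ] (Free Dm St v ×
      (StallerWon (⁅ v ⁆ ∪ St) ⊎ StallerWinsD k Dm (⁅ v ⁆ ∪ St)))
  StallerWinsD k Dm St =
    ∀ v → Free Dm St v →
      (¬ DominatorWon (⁅ v ⁆ ∪ Dm) × StallerWinsS k (⁅ v ⁆ ∪ Dm) St)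

  WinsD-within : ℕ → Set
  WinsD-within k = StallerWinsD k ⊥ ⊥

  WinsS-within : ℕ → Set
  WinsS-within k = StallerWinsS k ⊥ ⊥

  γSMB≡ : ℕ → Set
  γSMB≡ k = WinsD-within k × (∀ j → j < k → ¬ WinsD-within j)

  γ'SMB≡ : ℕ → Set
  γ'SMB≡ k = WinsS-within k × (∀ j → j < k → ¬ WinsS-within j)

{-# OPTIONS --safe #-}
module Submission where

-- A leaf ℓ with neighbour s forces every dominating set to meet {ℓ, s}; as
-- δ ≥ 1, these leaf edges are exactly the sets of at most two vertices whose
-- possession wins for Staller. At a strong support s she threatens two leaf
-- edges at once, so playing s wins in two moves. Conversely, if her first move
-- v wins in two, every reply w of Dominator leaves her a leaf edge at v
-- avoiding w, and two different replies give two leaves at v. In the D-game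
-- Dominator's first move spoils the star of at most one strong support.

open import Defs
open import Data.Nat as ℕ using (ℕ; zero; suc; _≤_; s≤s; z<s)
open import Data.Nat.Properties using (≤-antisym; <-irrefl; m<n⇒n≢0)
open import Data.Fin as Fin using (Fin; _≟_)
open import Data.Fin.Properties using (any?; ¬∀⟶∃¬)
open import Data.Fin.Subset using (Subset; _∈_; _∉_; _⊆_; _⊂_; ∣_∣; ⁅_⁆; _∪_; ⊥; ∁)
open import Data.Fin.Subset.Properties
  using (_∈?_; nonempty?; Empty-unique; ∣⊥∣≡0; ∉⊥; x∈⁅x⁆; x∈⁅y⁆⇒x≡y; x≢y⇒x∉⁅y⁆; ∣⁅x⁆∣≡1;
         p⊆q⇒∣p∣≤∣q∣; p⊂q⇒∣p∣<∣q∣; x∈∁p⇒x∉p; x∉∁p⇒x∈p; x∈p∪q⁺; x∈p∪q⁻; q⊆p∪q)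
open import Data.Bool as Bool using (true)
open import Data.Vec using (tabulate)
open import Data.Vec.Properties using (lookup∘tabulate; []=⇒lookup; lookup⇒[]=)
open import Data.Product using (∃-syntax; _×_; _,_; proj₁; proj₂; uncurry)
open import Data.Sum as Sum using (_⊎_; inj₁; inj₂; [_,_]; swap)
open import Data.Empty using (⊥-elim)
open import Function using (_∘_; id)
open import Relation.Nullary using (¬_; Dec; yes; no)
open import Relation.Nullary.Decidable using (_×-dec_; _⊎-dec_; decidable-stable)
open import Relation.Binary.PropositionalEquality using (_≡_; _≢_; refl; sym; trans; subst; cong)
open import Function.Bundles using (_⇔_; mk⇔)

private variable
  n : ℕ
  u v w x y z ℓ s a b : Fin n
  S D Dm St : Subset n

Fin-inhabited : {P : Fin n → Set} → ¬ (∀ v → P v) → Fin n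
Fin-inhabited {zero}  ¬∀ = ⊥-elim (¬∀ λ ())
Fin-inhabited {suc n} _  = Fin.zero

x∈⁅x⁆∪ : x ∈ ⁅ x ⁆ ∪ S
x∈⁅x⁆∪ {x = x} = x∈p∪q⁺ (inj₁ (x∈⁅x⁆ x))

∈⁅v⁆∪⁻ : x ∈ ⁅ v ⁆ ∪ S → x ≡ v ⊎ x ∈ S
∈⁅v⁆∪⁻ {v = v} {S = S} x∈ = Sum.map₁ (x∈⁅y⁆⇒x≡y v) (x∈p∪q⁻ ⁅ v ⁆ S x∈)

∈⁅v⁆∪⊥⁻ : x ∈ ⁅ v ⁆ ∪ ⊥ → x ≡ v
∈⁅v⁆∪⊥⁻ x∈ = [ id , ⊥-elim ∘ ∉⊥ ] (∈⁅v⁆∪⁻ x∈)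

∈⁅u,v⁆⁻ : x ∈ ⁅ u ⁆ ∪ (⁅ v ⁆ ∪ ⊥) → x ≡ u ⊎ x ≡ v
∈⁅u,v⁆⁻ = Sum.map₂ ∈⁅v⁆∪⊥⁻ ∘ ∈⁅v⁆∪⁻

∉⁅v⁆∪⁺ : x ≢ v → x ∉ S → x ∉ ⁅ v ⁆ ∪ S
∉⁅v⁆∪⁺ x≢v x∉S x∈ = [ x≢v , x∉S ] (∈⁅v⁆∪⁻ x∈)

∉⁅v⁆∪⁻ : x ∉ ⁅ v ⁆ ∪ S → x ≢ v × x ∉ S
∉⁅v⁆∪⁻ {S = S} x∉ = (λ { refl → x∉ x∈⁅x⁆∪ }) , x∉ ∘ q⊆p∪q _ S

module _ (G : Graph n) where
  open Graph G using (adj; irrefl)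

  adj? : ∀ u v → Dec (Adj G u v)
  adj? u v = adj u v Bool.≟ true

  Adj-sym : Adj G u v → Adj G v u
  Adj-sym {u = u} {v = v} uv = trans (Graph.sym G v u) uv

  Adj⇒≢ : Adj G u v → u ≢ v
  Adj⇒≢ {u = u} uu refl with trans (sym (irrefl u)) uu
  ... | ()

  Adj⇒∈N : Adj G u v → v ∈ N G u
  Adj⇒∈N {u = u} {v = v} uv = lookup⇒[]= v (tabulate (adj u)) (trans (lookup∘tabulate (adj u) v) uv)

  ∈N⇒Adj : v ∈ N G u → Adj G u v
  ∈N⇒Adj {v = v} {u = u} v∈ = trans (sym (lookup∘tabulate (adj u) v)) ([]=⇒lookup v∈)

  LeafOf : Fin n → Fin n → Set
  LeafOf ℓ s = Leaf G ℓ × Adj G ℓ s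

  LeafEdge : Fin n → Fin n → Set
  LeafEdge u v = LeafOf u v ⊎ LeafOf v u

  LeafOf? : ∀ ℓ s → Dec (LeafOf ℓ s)
  LeafOf? ℓ s = (deg G ℓ ℕ.≟ 1) ×-dec adj? ℓ s

  LeafEdge⇒≢ : LeafEdge u v → u ≢ v
  LeafEdge⇒≢ (inj₁ (_ , uv)) = Adj⇒≢ uv
  LeafEdge⇒≢ (inj₂ (_ , vu)) = Adj⇒≢ vu ∘ sym

  Leaf⇒nbr-unique : Leaf G ℓ → Adj G ℓ a → Adj G ℓ b → a ≡ b
  Leaf⇒nbr-unique {ℓ = ℓ} {a = a} {b = b} leaf ℓa ℓb with a ≟ b
  ... | yes a≡b = a≡b
  ... | no a≢b = ⊥-elim (<-irrefl (trans (∣⁅x⁆∣≡1 a) (sym leaf)) (p⊂q⇒∣p∣<∣q∣ ⁅a⁆⊂Nℓ))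
    where
    ⁅a⁆⊂Nℓ : ⁅ a ⁆ ⊂ N G ℓ
    ⁅a⁆⊂Nℓ = (λ x∈ → subst (_∈ N G ℓ) (sym (x∈⁅y⁆⇒x≡y a x∈)) (Adj⇒∈N ℓa))
           , b , Adj⇒∈N ℓb , x≢y⇒x∉⁅y⁆ (a≢b ∘ sym)

  LeafOf⇒LeafEdge-unique : LeafOf v s → LeafEdge u v → u ≡ s
  LeafOf⇒LeafEdge-unique (leaf , vs) (inj₁ (_ , uv)) = Leaf⇒nbr-unique leaf (Adj-sym uv) vs
  LeafOf⇒LeafEdge-unique (leaf , vs) (inj₂ (_ , vu)) = Leaf⇒nbr-unique leaf vu vs

  StrongSupport⇒¬Leaf : StrongSupport G s → ¬ Leaf G s
  StrongSupport⇒¬Leaf (_ , _ , a≢b , sa , sb , _) leaf = a≢b (Leaf⇒nbr-unique leaf sa sb)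

  Dominated : Subset n → Fin n → Set
  Dominated D v = v ∈ D ⊎ ∃[ u ] (u ∈ D × Adj G u v)

  dominated? : ∀ D v → Dec (Dominated D v)
  dominated? D v = (v ∈? D) ⊎-dec any? (λ u → (u ∈? D) ×-dec adj? u v)

  ¬Dominating⇒undominated : ¬ Dominating G D → ∃[ z ] ¬ Dominated D z
  ¬Dominating⇒undominated {D = D} = ¬∀⟶∃¬ n _ (dominated? D)

  Dominating⇒LeafOf-hit : LeafOf ℓ s → Dominating G D → ℓ ∈ D ⊎ s ∈ D
  Dominating⇒LeafOf-hit {ℓ = ℓ} {D = D} (leaf , ℓs) dom with dom ℓ
  ... | inj₁ ℓ∈D = inj₁ ℓ∈D
  ... | inj₂ (u , u∈D , uℓ) = inj₂ (subst (_∈ D) (Leaf⇒nbr-unique leaf (Adj-sym uℓ) ℓs) u∈D)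

  StallerWon-LeafOf : LeafOf ℓ s → ℓ ∈ St → s ∈ St → StallerWon G St
  StallerWon-LeafOf {ℓ = ℓ} {s = s} ℓs ℓ∈ s∈ D dom =
    [ (λ ℓ∈D → ℓ , ℓ∈D , ℓ∈) , (λ s∈D → s , s∈D , s∈) ] (Dominating⇒LeafOf-hit ℓs dom)

  ¬DominatorWon-LeafOf : LeafOf ℓ s → ℓ ∉ Dm → s ∉ Dm → ¬ DominatorWon G Dm
  ¬DominatorWon-LeafOf ℓs ℓ∉ s∉ (D , dom , D⊆Dm) =
    [ ℓ∉ ∘ D⊆Dm , s∉ ∘ D⊆Dm ] (Dominating⇒LeafOf-hit ℓs dom)

  ¬DominatorWon-⊥ : Fin n → ¬ DominatorWon G ⊥
  ¬DominatorWon-⊥ v (D , dom , D⊆⊥) = [ ∉⊥ ∘ D⊆⊥ , ∉⊥ ∘ D⊆⊥ ∘ proj₁ ∘ proj₂ ] (dom v)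

  StallerWon⇒¬Dominating-∁ : StallerWon G S → ¬ Dominating G (∁ S)
  StallerWon⇒¬Dominating-∁ {S = S} won dom with won (∁ S) dom
  ... | _ , x∈∁S , x∈S = x∈∁p⇒x∉p x∈∁S x∈S

  StallerWon⇒closedNbhd⊆ : StallerWon G S → ∃[ z ] (z ∈ S × ∀ {y} → Adj G z y → y ∈ S)
  StallerWon⇒closedNbhd⊆ won with ¬Dominating⇒undominated (StallerWon⇒¬Dominating-∁ won)
  ... | z , undominated =
    z , x∉∁p⇒x∈p (undominated ∘ inj₁) ,
    λ zy → x∉∁p⇒x∈p (λ y∈∁S → undominated (inj₂ (_ , y∈∁S , Adj-sym zy)))

  fullBoard⇒StallerWon : (∀ x → ¬ Free G Dm St x) → ¬ DominatorWon G Dm → StallerWon G St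
  fullBoard⇒StallerWon {Dm = Dm} {St = St} full ¬won D dom
    with any? (λ x → (x ∈? D) ×-dec (x ∈? St))
  ... | yes common = common
  ... | no disjoint = ⊥-elim (¬won (D , dom , D⊆Dm))
    where
    D⊆Dm : D ⊆ Dm
    D⊆Dm {x} x∈D =
      decidable-stable (x ∈? Dm) (λ x∉Dm → full x (x∉Dm , λ x∈St → disjoint (x , x∈D , x∈St)))

  -- StallerWinsD 0 holds exactly on a full board, so a last move of Staller
  -- either wins outright or fills the board.
  StallerWinsS-one⇒winningMove : ¬ DominatorWon G Dm → StallerWinsS G 1 Dm St →
                                 ∃[ u ] (Free G Dm St u × StallerWon G (⁅ u ⁆ ∪ St))
  StallerWinsS-one⇒winningMove ¬won (u , free , inj₁ won) = u , free , won
  StallerWinsS-one⇒winningMove ¬won (u , free , inj₂ over) =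
    u , free , fullBoard⇒StallerWon (λ x free′ → proj₂ (over x free′)) ¬won

  module _ (δ≥1 : MinDegAtLeast1 G) where

    nbr : ∀ v → ∃[ p ] Adj G v p
    nbr v with nonempty? (N G v)
    ... | yes (p , p∈) = p , ∈N⇒Adj p∈
    ... | no empty = ⊥-elim (m<n⇒n≢0 (δ≥1 v) (trans (cong ∣_∣ (Empty-unique empty)) (∣⊥∣≡0 n)))

    nbrs⊆⁅z,s⁆⇒LeafOf : (∀ {y} → Adj G z y → y ≡ z ⊎ y ≡ s) → LeafOf z s
    nbrs⊆⁅z,s⁆⇒LeafOf {z = z} {s = s} nbrs = ≤-antisym deg≤1 (δ≥1 z) , subst (Adj G z) (nbr≡s zp) zp
      where
      nbr≡s : ∀ {y} → Adj G z y → y ≡ s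
      nbr≡s zy = [ (λ y≡z → ⊥-elim (Adj⇒≢ zy (sym y≡z))) , id ] (nbrs zy)
      deg≤1 : deg G z ≤ 1
      deg≤1 = subst (deg G z ≤_) (∣⁅x⁆∣≡1 s)
                (p⊆q⇒∣p∣≤∣q∣ (λ y∈ → subst (_∈ ⁅ s ⁆) (sym (nbr≡s (∈N⇒Adj y∈))) (x∈⁅x⁆ s)))
      zp = proj₂ (nbr z)

    ¬StallerWon-⁅v⁆ : ¬ StallerWon G (⁅ v ⁆ ∪ ⊥)
    ¬StallerWon-⁅v⁆ won with StallerWon⇒closedNbhd⊆ won
    ... | z , z∈ , closed with nbr z
    ... | p , zp = Adj⇒≢ zp (trans (∈⁅v⁆∪⊥⁻ z∈) (sym (∈⁅v⁆∪⊥⁻ (closed zp))))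

    StallerWon-⁅u,v⁆⇒LeafEdge : StallerWon G (⁅ u ⁆ ∪ (⁅ v ⁆ ∪ ⊥)) → LeafEdge u v
    StallerWon-⁅u,v⁆⇒LeafEdge won with StallerWon⇒closedNbhd⊆ won
    ... | z , z∈ , closed with ∈⁅u,v⁆⁻ z∈
    ... | inj₁ refl = inj₁ (nbrs⊆⁅z,s⁆⇒LeafOf (∈⁅u,v⁆⁻ ∘ closed))
    ... | inj₂ refl = inj₂ (nbrs⊆⁅z,s⁆⇒LeafOf (swap ∘ ∈⁅u,v⁆⁻ ∘ closed))

    ¬StallerWinsS-one : ¬ DominatorWon G Dm → ¬ StallerWinsS G 1 Dm ⊥
    ¬StallerWinsS-one ¬won wins with StallerWinsS-one⇒winningMove ¬won wins
    ... | _ , _ , won = ¬StallerWon-⁅v⁆ won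

    ¬DominatorWon⇒free : ¬ DominatorWon G Dm → ∀ v → ∃[ w ] (w ∉ Dm × w ≢ v)
    ¬DominatorWon⇒free ¬won v with ¬Dominating⇒undominated (λ dom → ¬won (_ , dom , id))
    ... | z , undominated with z ≟ v
    ... | no z≢v = z , undominated ∘ inj₁ , z≢v
    ... | yes refl with nbr z
    ... | p , zp = p , (λ p∈ → undominated (inj₂ (p , p∈ , Adj-sym zp))) , Adj⇒≢ zp ∘ sym

    -- A second reply avoiding the first answer forces a second leaf, unless
    -- v is itself a leaf, in which case every answer is its unique neighbour.
    LeafEdgeAnswers⇒StrongSupport :
      ¬ DominatorWon G Dm →
      (∀ w → w ∉ Dm → w ≢ v → ∃[ u ] (u ∉ Dm × u ≢ w × LeafEdge u v)) →
      StrongSupport G v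
    LeafEdgeAnswers⇒StrongSupport {v = v} ¬won answer with ¬DominatorWon⇒free ¬won v
    ... | w , w∉ , w≢v with answer w w∉ w≢v
    ... | u₁ , u₁∉ , _ , e₁ with answer u₁ u₁∉ (LeafEdge⇒≢ e₁)
    ... | u₂ , _ , u₂≢u₁ , e₂ with e₁ | e₂
    ... | inj₂ v-leaf | _ = ⊥-elim (u₂≢u₁ (LeafOf⇒LeafEdge-unique v-leaf e₂))
    ... | inj₁ _ | inj₂ v-leaf = ⊥-elim (u₂≢u₁ (sym (LeafOf⇒LeafEdge-unique v-leaf e₁)))
    ... | inj₁ (leaf₁ , u₁v) | inj₁ (leaf₂ , u₂v) =
      u₁ , u₂ , u₂≢u₁ ∘ sym , Adj-sym u₁v , Adj-sym u₂v , leaf₁ , leaf₂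

    StallerWinsS-two⇒StrongSupport : ¬ DominatorWon G Dm → StallerWinsS G 2 Dm ⊥ →
                                     ∃[ v ] (v ∉ Dm × StrongSupport G v)
    StallerWinsS-two⇒StrongSupport ¬won (v , _ , inj₁ won) = ⊥-elim (¬StallerWon-⁅v⁆ won)
    StallerWinsS-two⇒StrongSupport {Dm = Dm} ¬won (v , (v∉ , _) , inj₂ replies) =
      v , v∉ , LeafEdgeAnswers⇒StrongSupport ¬won answer
      where
      answer : ∀ w → w ∉ Dm → w ≢ v → ∃[ u ] (u ∉ Dm × u ≢ w × LeafEdge u v)
      answer w w∉ w≢v with replies w (w∉ , ∉⁅v⁆∪⁺ w≢v ∉⊥)
      ... | ¬won′ , wins with StallerWinsS-one⇒winningMove ¬won′ wins
      ... | u , (u∉ , _) , won =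
        u , proj₂ (∉⁅v⁆∪⁻ u∉) , proj₁ (∉⁅v⁆∪⁻ u∉) , StallerWon-⁅u,v⁆⇒LeafEdge won

    StrongSupport⇒StallerWinsS-two : StrongSupport G x → x ∉ Dm → (∀ {ℓ} → LeafOf ℓ x → ℓ ∉ Dm) →
                                     StallerWinsS G 2 Dm ⊥
    StrongSupport⇒StallerWinsS-two {x = x} {Dm = Dm}
      (a₁ , a₂ , a₁≢a₂ , xa₁ , xa₂ , leaf₁ , leaf₂) x∉ leaves∉ =
      x , (x∉ , ∉⊥) , inj₂ reply
      where
      claim : ∀ {a w} → LeafOf a x → a ≢ w → w ≢ x →
              ¬ DominatorWon G (⁅ w ⁆ ∪ Dm) × StallerWinsS G 1 (⁅ w ⁆ ∪ Dm) (⁅ x ⁆ ∪ ⊥)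
      claim ax a≢w w≢x =
        ¬DominatorWon-LeafOf ax a∉ (∉⁅v⁆∪⁺ (w≢x ∘ sym) x∉) ,
        _ , (a∉ , ∉⁅v⁆∪⁺ (Adj⇒≢ (proj₂ ax)) ∉⊥) ,
        inj₁ (StallerWon-LeafOf ax x∈⁅x⁆∪ (q⊆p∪q _ _ x∈⁅x⁆∪))
        where
        a∉ = ∉⁅v⁆∪⁺ a≢w (leaves∉ ax)
      reply : StallerWinsD G 1 Dm (⁅ x ⁆ ∪ ⊥)
      reply w (_ , w∉) with w ≟ a₁ | proj₁ (∉⁅v⁆∪⁻ w∉)
      ... | yes refl | w≢x = claim (leaf₂ , Adj-sym xa₂) (a₁≢a₂ ∘ sym) w≢x
      ... | no w≢a₁  | w≢x = claim (leaf₁ , Adj-sym xa₁) (w≢a₁ ∘ sym) w≢x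

    StrongSupport⇒answers : StrongSupport G x → w ≢ x → ¬ LeafOf w x →
                            ¬ DominatorWon G (⁅ w ⁆ ∪ ⊥) × StallerWinsS G 2 (⁅ w ⁆ ∪ ⊥) ⊥
    StrongSupport⇒answers ss@(_ , _ , _ , xa₁ , _ , leaf₁ , _) w≢x ¬wx =
      ¬DominatorWon-LeafOf ax (leaves∉ ax) x∉ , StrongSupport⇒StallerWinsS-two ss x∉ leaves∉
      where
      ax = leaf₁ , Adj-sym xa₁
      x∉ = ∉⁅v⁆∪⁺ (w≢x ∘ sym) ∉⊥
      leaves∉ : ∀ {ℓ} → LeafOf ℓ _ → ℓ ∉ ⁅ _ ⁆ ∪ ⊥
      leaves∉ ℓx = ∉⁅v⁆∪⁺ (λ { refl → ¬wx ℓx }) ∉⊥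

    StrongSupports-cover : x ≢ y → StrongSupport G x → StrongSupport G y →
                           ∀ w → (w ≢ x × ¬ LeafOf w x) ⊎ (w ≢ y × ¬ LeafOf w y)
    StrongSupports-cover {x = x} x≢y ssx ssy w with w ≟ x
    ... | yes refl = inj₂ (x≢y , StrongSupport⇒¬Leaf ssx ∘ proj₁)
    ... | no w≢x with LeafOf? w x
    ... | no ¬wx = inj₁ (w≢x , ¬wx)
    ... | yes (leaf , wx) =
      inj₂ ( (λ { refl → StrongSupport⇒¬Leaf ssy leaf })
           , λ (_ , wy) → x≢y (Leaf⇒nbr-unique leaf wx wy))

    WinsD-within-two⇒StrongSupport : WinsD-within G 2 → ∀ w → ∃[ v ] (v ≢ w × StrongSupport G v)
    WinsD-within-two⇒StrongSupport wins w with uncurry StallerWinsS-two⇒StrongSupport (wins w (∉⊥ , ∉⊥))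
    ... | v , v∉ , ss = v , proj₁ (∉⁅v⁆∪⁻ v∉) , ss

    γSMB≡2⇔twoStrongSupports : γSMB≡ G 2 ⇔ (∃[ x ] ∃[ y ] (x ≢ y × StrongSupport G x × StrongSupport G y))
    γSMB≡2⇔twoStrongSupports = mk⇔ to from
      where
      to : γSMB≡ G 2 → ∃[ x ] ∃[ y ] (x ≢ y × StrongSupport G x × StrongSupport G y)
      to (wins , slower) with WinsD-within-two⇒StrongSupport wins (Fin-inhabited (slower 0 z<s))
      ... | x , _ , ssx with WinsD-within-two⇒StrongSupport wins x
      ... | y , y≢x , ssy = x , y , y≢x ∘ sym , ssx , ssy
      from : ∃[ x ] ∃[ y ] (x ≢ y × StrongSupport G x × StrongSupport G y) → γSMB≡ G 2
      from (x , y , x≢y , ssx , ssy) = wins , slower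
        where
        wins : WinsD-within G 2
        wins w _ = [ uncurry (StrongSupport⇒answers ssx) , uncurry (StrongSupport⇒answers ssy) ]
                     (StrongSupports-cover x≢y ssx ssy w)
        slower : ∀ j → j ℕ.< 2 → ¬ WinsD-within G j
        slower 0 _ wins = proj₂ (wins x (∉⊥ , ∉⊥))
        slower 1 _ wins = uncurry ¬StallerWinsS-one (wins x (∉⊥ , ∉⊥))
        slower (suc (suc _)) (s≤s (s≤s ()))

    γ'SMB≡2⇔strongSupport : γ'SMB≡ G 2 ⇔ (∃[ x ] StrongSupport G x)
    γ'SMB≡2⇔strongSupport = mk⇔ to from
      where
      to : γ'SMB≡ G 2 → ∃[ x ] StrongSupport G x
      to (wins@(v , _) , _) with StallerWinsS-two⇒StrongSupport (¬DominatorWon-⊥ v) wins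
      ... | x , _ , ss = x , ss
      from : ∃[ x ] StrongSupport G x → γ'SMB≡ G 2
      from (x , ss) = StrongSupport⇒StallerWinsS-two ss ∉⊥ (λ _ → ∉⊥) , slower
        where
        slower : ∀ j → j ℕ.< 2 → ¬ WinsS-within G j
        slower 0 _ ()
        slower 1 _ = ¬StallerWinsS-one (¬DominatorWon-⊥ x)
        slower (suc (suc _)) (s≤s (s≤s ()))

proposition4p4 : ∀ {n : ℕ} (G : Graph n) → MinDegAtLeast1 G →
    (γSMB≡ G 2 ⇔ (∃[ x ] ∃[ y ] (x ≢ y × StrongSupport G x × StrongSupport G y)))
    × (γ'SMB≡ G 2 ⇔ (∃[ x ] StrongSupport G x))
proposition4p4 G δ≥1 = γSMB≡2⇔twoStrongSupports G δ≥1 , γ'SMB≡2⇔strongSupport G δ≥1
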